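{- Let $n\ge1$ and $d$ be integers with $|d|\ge2$. Then $\Sigma(n,d)/S(n,d)\cong\mathbb{Z}_n$; in particular $|\Sigma(n,d)|=n\,|S(n,d)|$.
   Context: In $\mathbb{Q}[x,x^{ -1}]/(x^n-1)$ (exponents mod $n$) put $e_v=x^v-1$, $\epsilon_v=d\,e_v-e_{dv}$; $\mathcal Z_n$ = $\mathbb{Z}$-span of $e_1,\dots,e_{n-1}$, $\mathcal E_{n,d}$ = $\mathbb{Z}$-span of $\epsilon_1,\dots,\epsilon_{n-1}$, $\Sigma(n,d)=\mathcal Z_n/\mathcal E_{n,d}$. With $f_v=dx^v-\sum_{i=0}^{d-1}x^{dv+i}$ ($d\ge2$), resp. $f_v=dx^v+\sum_{i=0}^{|d|-1}x^{d(v+1)+i}$ ($d\le-2$), $S(n,d)=\mathcal Z_n/\langle f_1,\dots,f_{n-1}\rangle_{\mathbb{Z}}$, regarded as a subgroup of $\Sigma(n,d)$ via the injective homomorphism induced by $c\mapsto(x-1)c$. -}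

module Defs where

open import Data.Nat as ℕ using (ℕ; zero; suc; NonZero)
open import Data.Integer as ℤ using (ℤ; +_; -[1+_]; _+_; _-_; _*_; -_; _%ℕ_; ∣_∣)
open import Data.Integer.Divisibility using (_∣_)
open import Data.Fin using (Fin; toℕ)
open import Data.Bool using (if_then_else_)
open import Relation.Nullary.Decidable using (⌊_⌋)
open import Relation.Binary.PropositionalEquality using (_≡_)
open import Data.Product using (Σ; Σ-syntax; ∃; ∃-syntax; _×_)
open import Function.Bundles using (_⇔_)

-- Elements of Q[x,x^{-1}]/(x^n-1) with integer coefficients: coefficient
-- vectors indexed by the exponent class  i ∈ Fin n  (i.e. the group ring Z[C_n]).
R : ℕ → Set
R n = Fin n → ℤ

module _ (n : ℕ) .{{_ : NonZero n}} where

  0R : R n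
  0R _ = + 0

  _⊕_ : R n → R n → R n
  (a ⊕ b) i = a i + b i

  _⊖_ : R n → R n → R n
  (a ⊖ b) i = a i - b i

  _•_ : ℤ → R n → R n
  (k • a) i = k * a i

  sumFin : ∀ {k} → (Fin k → ℤ) → ℤ
  sumFin {zero} g = + 0
  sumFin {suc k} g = g Fin.zero + sumFin (λ j → g (Fin.suc j))

  _⊛_ : R n → R n → R n
  (a ⊛ b) i = sumFin (λ j → sumFin (λ k →
      if ⌊ ((toℕ j ℕ.+ toℕ k) ℕ.% n) ℕ.≟ toℕ i ⌋ then a j * b k else + 0))

  mono : ℤ → R n
  mono k i = if ⌊ (k %ℕ n) ℕ.≟ toℕ i ⌋ then + 1 else + 0

  sumR : ℕ → (ℕ → R n) → R n
  sumR zero g = 0R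
  sumR (suc m) g = sumR m g ⊕ g m

  e : ℤ → R n
  e v = mono v ⊖ mono (+ 0)

  ε : ℤ → ℤ → R n
  ε d v = (d • e v) ⊖ e (d * v)

  -- f_v (d ≥ 2 resp. d ≤ -2; the values for |d| < 2 are irrelevant)
  f : ℤ → ℤ → R n
  f (+ k) v = ((+ k) • mono v) ⊖ sumR k (λ i → mono ((+ k) * v + + i))
  f d@(-[1+ k ]) v = (d • mono v) ⊕ sumR (suc k) (λ i → mono (d * (v + + 1) + + i))

  -- Σ_{v=1}^{m} c_v g_v
  lincomb : (ℤ → R n) → (ℕ → ℤ) → ℕ → R n
  lincomb g c zero = 0R
  lincomb g c (suc m) = lincomb g c m ⊕ (c (suc m) • g (+ suc m))

  InSpan : (ℤ → R n) → R n → Set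
  InSpan g a = Σ[ c ∈ (ℕ → ℤ) ] (∀ i → a i ≡ lincomb g c (n ℕ.∸ 1) i)

  Zn : R n → Set
  Zn = InSpan e

  -- congruence modulo ℰ_{n,d}  (equality in Σ(n,d) = 𝒵_n/ℰ_{n,d})
  ≈Σ : ℤ → R n → R n → Set
  ≈Σ d a b = InSpan (ε d) (a ⊖ b)

  -- congruence modulo ⟨f_1,…,f_{n-1}⟩  (equality in S(n,d))
  ≈S : ℤ → R n → R n → Set
  ≈S d a b = InSpan (f d) (a ⊖ b)

  -- the map S(n,d) → Σ(n,d), c ↦ (x-1)c
  ι : R n → R n
  ι c = (mono (+ 1) ⊖ mono (+ 0)) ⊛ c

  -- equality in Σ(n,d)/ι(S(n,d)):  a - b ≡ ι(c) mod ℰ_{n,d} for some c ∈ 𝒵_n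
  ≈Q : ℤ → R n → R n → Set
  ≈Q d a b = Σ[ c ∈ R n ] (Zn c × ≈Σ d (a ⊖ b) (ι c))

  -- The quotient of 𝒵_n by the equivalence _~_ is isomorphic (as a group) to ℤ/nℤ:
  -- there is a map φ : 𝒵_n → ℤ which is additive modulo n, surjective modulo n,
  -- and such that a ~ b iff φ a ≡ φ b (mod n).
  QuotIsoZmod : (R n → R n → Set) → Set
  QuotIsoZmod _~_ = Σ[ φ ∈ (R n → ℤ) ]
      ((∀ a b → Zn a → Zn b → (+ n) ∣ (φ (a ⊕ b) - (φ a + φ b)))
     × (∀ k → Σ[ a ∈ R n ] (Zn a × (+ n) ∣ (φ a - k)))
     × (∀ a b → Zn a → Zn b → (a ~ b ⇔ (+ n) ∣ (φ a - φ b))))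

  -- the quotient of 𝒵_n by _~_ has exactly m elements
  HasSize : (R n → R n → Set) → ℕ → Set
  HasSize _~_ m = Σ[ r ∈ (Fin m → R n) ]
      ((∀ i → Zn (r i))
     × (∀ a → Zn a → Σ[ i ∈ Fin m ] (a ~ r i))
     × (∀ i j → r i ~ r j → i ≡ j))

module Submission where

-- Two linear
-- functionals drive the proof: the augmentation  aug a = Σ_i a_i, which vanishes on 𝒵_N and
-- on every f_v, and the index weight  φ a = Σ_i i·a_i, for which φ e_t ≡ t (mod N), so that
-- φ vanishes mod N on every ε_v and on ι(𝒵_N).  Multiplication by x − 1 acts pointwise as
-- ι c i = c (i−1) − c i; hence its kernel consists of the constant vectors, it sends
-- f_v to ε_{v+1} − ε_v, and sums of translates of a vector telescope under it.  This gives
--   (A) the image lemma:  s ∈ 𝒵_N with φ s ≡ 0 (mod N) is ι c for some c ∈ 𝒵_N;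
--   (B) the kernel lemma: c ∈ 𝒵_N with ι c ∈ ℰ_{N,d} lies in ⟨f_1,…,f_{N−1}⟩.
-- Then φ induces Σ/ι(S) ≅ ℤ/N; the classes k·e_1 + ι r (k < N, r running over representatives
-- of S) are exactly the classes of Σ; conversely the representatives s of Σ with φ s ≡ 0
-- pull back along ι to representatives of S, and |Σ| = N·|S| because the size of a finite
-- quotient is unique.

open import Defs
open import Data.Nat using (ℕ; NonZero; _≤_; _*_)
open import Data.Integer using (ℤ; ∣_∣)
open import Data.Product using (Σ-syntax; _×_)
open import Relation.Binary.PropositionalEquality using (_≡_)

open import Level using (0ℓ)
import Data.Nat as ℕ
open import Data.Nat using (zero; suc; _<_; _∸_; z≤n; s≤s)
import Data.Nat.Properties as ℕP
import Data.Nat.DivMod as ℕD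
import Data.Nat.Divisibility as ℕDiv
open import Data.Integer using (+_; -[1+_]; _+_; _-_; -_; _%ℕ_; _/ℕ_) renaming (_*_ to _·_)
import Data.Integer.Properties as ℤP
open import Data.Integer.DivMod using (n%ℕd<d; a≡a%ℕn+[a/ℕn]*n)
open import Data.Integer.Divisibility.Signed
  using (_∣_; divides; _∣?_; ∣⇒∣ᵤ; ∣ᵤ⇒∣; 0∣⇒≡0; ∣m∣n⇒∣m+n; ∣m⇒∣-m; ∣n⇒∣m*n)
open import Data.Integer.Tactic.RingSolver using (solve-∀)
open import Data.Fin using (Fin; zero; suc; toℕ; fromℕ; fromℕ<; inject₁; combine; remQuot)
import Data.Fin.Properties as FinP
open import Data.Bool using (Bool; true; false; if_then_else_)
open import Data.Product using (_,_; proj₁; proj₂; uncurry)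
open import Data.Integer.Divisibility using () renaming (_∣_ to _∣ᵤ_)
open import Data.Empty using (⊥-elim)
open import Function.Bundles using (mk⇔)
open import Relation.Binary.Bundles using (Setoid)
import Relation.Binary.Reasoning.Setoid as SetoidReasoning
open import Relation.Nullary using (Dec; yes; no; ¬_)
open import Relation.Nullary.Decidable using (⌊_⌋; map′; does-⇔; isYes≗does)
open import Relation.Binary.PropositionalEquality
  using (refl; sym; trans; cong; cong₂; subst; _≢_; module ≡-Reasoning)

-- An injective listing of exactly those j : Fin K that satisfy P; it is used to count the
-- classes of Σ that lie in ι(S).
record Enumeration (K : ℕ) (P : Fin K → Set) : Set where
  field
    count          : ℕ
    elem           : Fin count → Fin K
    elem-injective : ∀ a b → elem a ≡ elem b → a ≡ b
    elem-sat       : ∀ a → P (elem a)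
    elem-complete  : ∀ j → P j → Σ[ a ∈ Fin count ] (elem a ≡ j)

enum-keep : ∀ {K} {P : Fin (suc K) → Set} → P zero →
            Enumeration K (λ j → P (suc j)) → Enumeration (suc K) P
enum-keep {K} {P} p0 E = record
  { count = suc count ; elem = elem′ ; elem-injective = injective′
  ; elem-sat = sat′ ; elem-complete = complete′ }
  where
  open Enumeration E
  elem′ : Fin (suc count) → Fin (suc K)
  elem′ zero = zero
  elem′ (suc a) = suc (elem a)
  injective′ : ∀ a b → elem′ a ≡ elem′ b → a ≡ b
  injective′ zero zero _ = refl
  injective′ (suc a) (suc b) eq = cong suc (elem-injective a b (FinP.suc-injective eq))
  injective′ zero (suc _) ()
  injective′ (suc _) zero ()
  sat′ : ∀ a → P (elem′ a)
  sat′ zero = p0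
  sat′ (suc a) = elem-sat a
  complete′ : ∀ j → P j → Σ[ a ∈ Fin (suc count) ] (elem′ a ≡ j)
  complete′ zero _ = zero , refl
  complete′ (suc j) pj = let (a , eq) = elem-complete j pj in suc a , cong suc eq

enum-skip : ∀ {K} {P : Fin (suc K) → Set} → ¬ P zero →
            Enumeration K (λ j → P (suc j)) → Enumeration (suc K) P
enum-skip {K} {P} ¬p0 E = record
  { count = count ; elem = λ a → suc (elem a)
  ; elem-injective = λ a b eq → elem-injective a b (FinP.suc-injective eq)
  ; elem-sat = elem-sat ; elem-complete = complete′ }
  where
  open Enumeration E
  complete′ : ∀ j → P j → Σ[ a ∈ Fin count ] (suc (elem a) ≡ j)
  complete′ zero p0 = ⊥-elim (¬p0 p0)
  complete′ (suc j) pj = let (a , eq) = elem-complete j pj in a , cong suc eq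

enumerate : ∀ K {P : Fin K → Set} → (∀ j → Dec (P j)) → Enumeration K P
enumerate zero P? = record
  { count = 0 ; elem = λ () ; elem-injective = λ () ; elem-sat = λ () ; elem-complete = λ () }
enumerate (suc K) P? with P? zero
... | yes p0 = enum-keep p0 (enumerate K (λ j → P? (suc j)))
... | no ¬p0 = enum-skip ¬p0 (enumerate K (λ j → P? (suc j)))

-- Congruence of integers modulo n, as a setoid with its compatibility laws.  It is a record
-- (rather than a synonym for  n ∣ a − b) so that a and b can be inferred from it.
module Congruence (n : ℕ) where
  infix 4 _≋_ _≋?_
  record _≋_ (a b : ℤ) : Set where
    constructor mod
    field divides-difference : + n ∣ a - b
  open _≋_ public

  ≋-reflexive : ∀ {a b} → a ≡ b → a ≋ b
  ≋-reflexive {a} refl = mod (divides (+ 0) (ℤP.+-inverseʳ a))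

  _≋?_ : ∀ a b → Dec (a ≋ b)
  a ≋? b = map′ mod divides-difference (+ n ∣? a - b)

  ≋-refl : ∀ {a} → a ≋ a
  ≋-refl = ≋-reflexive refl

  ≋-sym : ∀ {a b} → a ≋ b → b ≋ a
  ≋-sym {a} {b} (mod a≋b) = mod (subst (+ n ∣_) (negate a b) (∣m⇒∣-m a≋b))
    where
    negate : ∀ a b → - (a - b) ≡ b - a
    negate = solve-∀

  ≋-trans : ∀ {a b c} → a ≋ b → b ≋ c → a ≋ c
  ≋-trans {a} {b} {c} (mod a≋b) (mod b≋c) = mod (subst (+ n ∣_) (chain a b c) (∣m∣n⇒∣m+n a≋b b≋c))
    where
    chain : ∀ a b c → (a - b) + (b - c) ≡ a - c
    chain = solve-∀

  +-cong-≋ : ∀ {a b c d} → a ≋ b → c ≋ d → a + c ≋ b + d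
  +-cong-≋ {a} {b} {c} {d} (mod a≋b) (mod c≋d) =
    mod (subst (+ n ∣_) (regroup a b c d) (∣m∣n⇒∣m+n a≋b c≋d))
    where
    regroup : ∀ a b c d → (a - b) + (c - d) ≡ (a + c) - (b + d)
    regroup = solve-∀

  -‿cong-≋ : ∀ {a b c d} → a ≋ b → c ≋ d → a - c ≋ b - d
  -‿cong-≋ {a} {b} {c} {d} (mod a≋b) (mod c≋d) =
    mod (subst (+ n ∣_) (regroup a b c d) (∣m∣n⇒∣m+n a≋b (∣m⇒∣-m c≋d)))
    where
    regroup : ∀ a b c d → (a - b) + - (c - d) ≡ (a - c) - (b - d)
    regroup = solve-∀

  ·-congˡ-≋ : ∀ k {a b} → a ≋ b → k · a ≋ k · b
  ·-congˡ-≋ k {a} {b} (mod a≋b) = mod (subst (+ n ∣_) (distrib k a b) (∣n⇒∣m*n k a≋b))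
    where
    distrib : ∀ k a b → k · (a - b) ≡ k · a - k · b
    distrib = solve-∀

  multiple≋0 : ∀ k → k · + n ≋ + 0
  multiple≋0 k = mod (divides k (ℤP.+-identityʳ (k · + n)))

  ∣⇒≋0 : ∀ {x} → + n ∣ x → x ≋ + 0
  ∣⇒≋0 {x} n∣x = mod (subst (+ n ∣_) (sym (ℤP.+-identityʳ x)) n∣x)

  ≋0⇒∣ : ∀ {x} → x ≋ + 0 → + n ∣ x
  ≋0⇒∣ {x} (mod n∣x-0) = subst (+ n ∣_) (ℤP.+-identityʳ x) n∣x-0

  ≋0⇒≋ : ∀ {a b} → a - b ≋ + 0 → a ≋ b
  ≋0⇒≋ a-b≋0 = mod (≋0⇒∣ a-b≋0)

  ≋⇒≋0 : ∀ {a b} → a ≋ b → a - b ≋ + 0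
  ≋⇒≋0 (mod n∣a-b) = ∣⇒≋0 n∣a-b

  ≋⇒∣ᵤ : ∀ {a b} → a ≋ b → + n ∣ᵤ a - b
  ≋⇒∣ᵤ (mod n∣a-b) = ∣⇒∣ᵤ n∣a-b

  ∣ᵤ⇒≋ : ∀ {a b} → + n ∣ᵤ a - b → a ≋ b
  ∣ᵤ⇒≋ n∣a-b = mod (∣ᵤ⇒∣ n∣a-b)

  ≋-setoid : Setoid 0ℓ 0ℓ
  ≋-setoid = record
    { Carrier = ℤ ; _≈_ = _≋_
    ; isEquivalence = record { refl = ≋-refl ; sym = ≋-sym ; trans = ≋-trans } }

  module ≋-Reasoning = SetoidReasoning ≋-setoid

  module _ .{{_ : NonZero n}} where
    ≋-residue : ∀ t → t ≋ + (t %ℕ n)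
    ≋-residue t = mod (divides (t /ℕ n) (begin
        t - + r              ≡⟨ cong (_- + r) (a≡a%ℕn+[a/ℕn]*n t n) ⟩
        (+ r + q · + n) - + r ≡⟨ cancel (+ r) (q · + n) ⟩
        q · + n               ∎))
      where
      open ≡-Reasoning
      r : ℕ
      r = t %ℕ n
      q : ℤ
      q = t /ℕ n
      cancel : ∀ r x → (r + x) - r ≡ x
      cancel = solve-∀

    small-multiple≡0 : ∀ x → ∣ x ∣ < n → + n ∣ x → x ≡ + 0
    small-multiple≡0 x |x|<n n∣x = ℤP.∣i∣≡0⇒i≡0 (natural ∣ x ∣ |x|<n (∣⇒∣ᵤ n∣x))
      where
      natural : ∀ k → k < n → n ℕDiv.∣ k → k ≡ 0
      natural zero _ _ = refl
      natural (suc k) k<n n∣k = ⊥-elim (ℕP.<⇒≱ k<n (ℕDiv.∣⇒≤ n∣k))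

    ≋⇒≡ : ∀ {u v} → u < n → v < n → + u ≋ + v → u ≡ v
    ≋⇒≡ {u} {v} u<n v<n (mod n∣u-v) =
      ℤP.+-injective (ℤP.i-j≡0⇒i≡j (+ u) (+ v) (small-multiple≡0 (+ u - + v) bound n∣u-v))
      where
      bound : ∣ + u - + v ∣ < n
      bound = subst (_< n) (cong ∣_∣ (sym (ℤP.m-n≡m⊖n u v)))
                (ℕP.≤-<-trans (ℤP.∣m⊝n∣≤m⊔n u v) (ℕP.⊔-lub u<n v<n))

    ≋⇒residue≡ : ∀ s t → s ≋ t → s %ℕ n ≡ t %ℕ n
    ≋⇒residue≡ s t s≋t = ≋⇒≡ (n%ℕd<d s n) (n%ℕd<d t n)
      (≋-trans (≋-sym (≋-residue s)) (≋-trans s≋t (≋-residue t)))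

    residue≡⇒≋ : ∀ s t → s %ℕ n ≡ t %ℕ n → s ≋ t
    residue≡⇒≋ s t eq =
      ≋-trans (≋-residue s) (≋-trans (≋-reflexive (cong +_ eq)) (≋-sym (≋-residue t)))

if-mul : ∀ (b : Bool) a x → (if b then a · x else + 0) ≡ a · (if b then x else + 0)
if-mul true a x = refl
if-mul false a x = sym (ℤP.*-zeroʳ a)

if-one : ∀ (b : Bool) x → (if b then + 1 else + 0) · x ≡ (if b then x else + 0)
if-one true x = ℤP.*-identityˡ x
if-one false x = refl

module FinSums (n : ℕ) .{{_ : NonZero n}} where
  Σf : ∀ {k} → (Fin k → ℤ) → ℤ
  Σf = sumFin n

  sum-cong : ∀ {k} {g h : Fin k → ℤ} → (∀ i → g i ≡ h i) → Σf g ≡ Σf h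
  sum-cong {zero} eq = refl
  sum-cong {suc k} eq = cong₂ _+_ (eq zero) (sum-cong (λ i → eq (suc i)))

  sum-zero : ∀ {k} {g : Fin k → ℤ} → (∀ i → g i ≡ + 0) → Σf g ≡ + 0
  sum-zero {zero} eq = refl
  sum-zero {suc k} eq = cong₂ _+_ (eq zero) (sum-zero (λ i → eq (suc i)))

  sum-single : ∀ {k} (g : Fin k → ℤ) (k₀ : Fin k) → (∀ j → j ≢ k₀ → g j ≡ + 0) → Σf g ≡ g k₀
  sum-single {suc k} g zero others =
    trans (cong (_+_ (g zero)) (sum-zero (λ i → others (suc i) (λ ())))) (ℤP.+-identityʳ (g zero))
  sum-single {suc k} g (suc k₀) others =
    trans (cong₂ _+_ (others zero (λ ()))
                     (sum-single (λ i → g (suc i)) k₀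
                        (λ j j≢k₀ → others (suc j) (λ eq → j≢k₀ (FinP.suc-injective eq)))))
          (ℤP.+-identityˡ _)

  sum-select : ∀ {k} {P : Fin k → Set} (P? : ∀ j → Dec (P j)) (g : Fin k → ℤ) (k₀ : Fin k) →
               P k₀ → (∀ j → P j → j ≡ k₀) →
               Σf (λ j → if ⌊ P? j ⌋ then g j else + 0) ≡ g k₀
  sum-select {P = P} P? g k₀ pk₀ unique = trans (sum-single _ k₀ vanish) (at-k₀ (P? k₀))
    where
    vanish : ∀ j → j ≢ k₀ → (if ⌊ P? j ⌋ then g j else + 0) ≡ + 0
    vanish j j≢k₀ with P? j
    ... | yes pj = ⊥-elim (j≢k₀ (unique j pj))
    ... | no _ = refl
    at-k₀ : (d : Dec (P k₀)) → (if ⌊ d ⌋ then g k₀ else + 0) ≡ g k₀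
    at-k₀ (yes _) = refl
    at-k₀ (no ¬p) = ⊥-elim (¬p pk₀)

  sum-add : ∀ {k} (g h : Fin k → ℤ) → Σf (λ i → g i + h i) ≡ Σf g + Σf h
  sum-add {zero} g h = refl
  sum-add {suc k} g h =
    trans (cong (_+_ (g zero + h zero)) (sum-add (λ i → g (suc i)) (λ i → h (suc i))))
          (interchange (g zero) (h zero) _ _)
    where
    interchange : ∀ a b c d → (a + b) + (c + d) ≡ (a + c) + (b + d)
    interchange = solve-∀

  sum-sub : ∀ {k} (g h : Fin k → ℤ) → Σf (λ i → g i - h i) ≡ Σf g - Σf h
  sum-sub {zero} g h = refl
  sum-sub {suc k} g h =
    trans (cong (_+_ (g zero - h zero)) (sum-sub (λ i → g (suc i)) (λ i → h (suc i))))
          (interchange (g zero) (h zero) _ _)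
    where
    interchange : ∀ a b c d → (a - b) + (c - d) ≡ (a + c) - (b + d)
    interchange = solve-∀

  sum-scale : ∀ {k} (z : ℤ) (g : Fin k → ℤ) → Σf (λ i → z · g i) ≡ z · Σf g
  sum-scale {zero} z g = sym (ℤP.*-zeroʳ z)
  sum-scale {suc k} z g =
    trans (cong (_+_ (z · g zero)) (sum-scale z (λ i → g (suc i))))
          (sym (ℤP.*-distribˡ-+ z (g zero) _))

  sum-const : ∀ {k} (z : ℤ) → Σf {k} (λ _ → z) ≡ + k · z
  sum-const {zero} z = refl
  sum-const {suc k} z = trans (cong (_+_ z) (sum-const {k} z)) (one-more (+ k) z)
    where
    one-more : ∀ k z → z + k · z ≡ (+ 1 + k) · z
    one-more = solve-∀

module Cyclic (m : ℕ) where
  N : ℕ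
  N = suc m

  open FinSums N
  open Congruence N

  infix 4 _≗_
  infixl 6 _⊞_ _⊟_
  infixl 7 _⊡_

  _≗_ : R N → R N → Set
  a ≗ b = ∀ i → a i ≡ b i

  ≗-sym : ∀ {a b} → a ≗ b → b ≗ a
  ≗-sym a≗b i = sym (a≗b i)

  ≗-trans : ∀ {a b c} → a ≗ b → b ≗ c → a ≗ c
  ≗-trans a≗b b≗c i = trans (a≗b i) (b≗c i)

  _⊞_ : R N → R N → R N
  _⊞_ = _⊕_ N

  _⊟_ : R N → R N → R N
  _⊟_ = _⊖_ N

  _⊡_ : ℤ → R N → R N
  _⊡_ = _•_ N

  𝟘 : R N
  𝟘 = 0R N

  ⟦_⟧ : ℤ → Fin N
  ⟦ t ⟧ = fromℕ< (n%ℕd<d t N)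

  toℕ-⟦⟧ : ∀ t → toℕ ⟦ t ⟧ ≡ t %ℕ N
  toℕ-⟦⟧ t = FinP.toℕ-fromℕ< (n%ℕd<d t N)

  pred : Fin N → Fin N
  pred zero = fromℕ m
  pred (suc j) = inject₁ j

  suc-pred : ∀ i → suc (toℕ (pred i)) ℕ.% N ≡ toℕ i
  suc-pred zero rewrite FinP.toℕ-fromℕ m = ℕD.n%n≡0 N
  suc-pred (suc j) rewrite FinP.toℕ-inject₁ j = ℕD.m<n⇒m%n≡m (FinP.toℕ<n (suc j))

  pred-unique : ∀ k i → suc (toℕ k) ℕ.% N ≡ toℕ i → k ≡ pred i
  pred-unique k i eq = FinP.toℕ-injective (≋⇒≡ (FinP.toℕ<n k) (FinP.toℕ<n (pred i))
      (mod (subst (+ N ∣_) (drop-suc (toℕ k) (toℕ (pred i))) (divides-difference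
        (residue≡⇒≋ (+ suc (toℕ k)) (+ suc (toℕ (pred i))) (trans eq (sym (suc-pred i))))))))
    where
    drop-suc : ∀ x y → + suc x - + suc y ≡ + x - + y
    drop-suc x y = trans (ℤP.m-n≡m⊖n (suc x) (suc y))
                     (trans (ℤP.[1+m]⊖[1+n]≡m⊖n x y) (sym (ℤP.m-n≡m⊖n x y)))

  +suc : ∀ v → + suc v ≡ + v + + 1
  +suc v = cong +_ (ℕP.+-comm 1 v)

  residue-suc : ∀ t → (t + + 1) %ℕ N ≡ suc (t %ℕ N) ℕ.% N
  residue-suc t = trans (≋⇒residue≡ (t + + 1) (+ (t %ℕ N) + + 1) (+-cong-≋ (≋-residue t) ≋-refl))
                        (cong (ℕ._% N) (ℕP.+-comm (t %ℕ N) 1))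

  mono-periodic : ∀ s t → s ≋ t → mono N s ≗ mono N t
  mono-periodic s t s≋t i = cong (λ r → if ⌊ r ℕ.≟ toℕ i ⌋ then + 1 else + 0) (≋⇒residue≡ s t s≋t)

  mono-succ : ∀ t i → mono N (t + + 1) i ≡ mono N t (pred i)
  mono-succ t i = cong (λ b → if b then + 1 else + 0)
    (trans (isYes≗does shifted?)
           (trans (does-⇔ (mk⇔ to from) shifted? unshifted?) (sym (isYes≗does unshifted?))))
    where
    shifted? : Dec ((t + + 1) %ℕ N ≡ toℕ i)
    shifted? = (t + + 1) %ℕ N ℕ.≟ toℕ i
    unshifted? : Dec (t %ℕ N ≡ toℕ (pred i))
    unshifted? = t %ℕ N ℕ.≟ toℕ (pred i)
    from : t %ℕ N ≡ toℕ (pred i) → (t + + 1) %ℕ N ≡ toℕ i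
    from eq = trans (residue-suc t) (trans (cong (λ r → suc r ℕ.% N) eq) (suc-pred i))
    to : (t + + 1) %ℕ N ≡ toℕ i → t %ℕ N ≡ toℕ (pred i)
    to eq = trans (sym (toℕ-⟦⟧ t)) (cong toℕ (pred-unique ⟦ t ⟧ i
              (trans (cong (λ r → suc r ℕ.% N) (toℕ-⟦⟧ t)) (trans (sym (residue-suc t)) eq))))

  Λ : (Fin N → ℤ) → R N → ℤ
  Λ w a = Σf (λ i → a i · w i)

  Λ-resp : ∀ w {a b} → a ≗ b → Λ w a ≡ Λ w b
  Λ-resp w a≗b = sum-cong (λ i → cong (_· w i) (a≗b i))

  Λ-zero : ∀ w → Λ w 𝟘 ≡ + 0
  Λ-zero w = sum-zero {g = λ i → + 0 · w i} (λ i → refl)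

  Λ-add : ∀ w a b → Λ w (a ⊞ b) ≡ Λ w a + Λ w b
  Λ-add w a b = trans (sum-cong (λ i → ℤP.*-distribʳ-+ (w i) (a i) (b i)))
                      (sum-add (λ i → a i · w i) (λ i → b i · w i))

  Λ-sub : ∀ w a b → Λ w (a ⊟ b) ≡ Λ w a - Λ w b
  Λ-sub w a b = trans (sum-cong (λ i → distrib (a i) (b i) (w i)))
                      (sum-sub (λ i → a i · w i) (λ i → b i · w i))
    where
    distrib : ∀ x y z → (x - y) · z ≡ x · z - y · z
    distrib = solve-∀

  Λ-scale : ∀ w z a → Λ w (z ⊡ a) ≡ z · Λ w a
  Λ-scale w z a = trans (sum-cong (λ i → ℤP.*-assoc z (a i) (w i))) (sum-scale z (λ i → a i · w i))

  Λ-mono : ∀ w t → Λ w (mono N t) ≡ w ⟦ t ⟧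
  Λ-mono w t = trans (sum-cong (λ j → if-one ⌊ t %ℕ N ℕ.≟ toℕ j ⌋ (w j)))
    (sum-select (λ j → t %ℕ N ℕ.≟ toℕ j) w ⟦ t ⟧ (sym (toℕ-⟦⟧ t))
       (λ j eq → FinP.toℕ-injective (trans (sym eq) (sym (toℕ-⟦⟧ t)))))

  -- The coefficient of x^i in x^j·c; the product is a weighted sum of these.
  shifted : R N → Fin N → Fin N → ℤ
  shifted c i j = Σf (λ k → if ⌊ (toℕ j ℕ.+ toℕ k) ℕ.% N ℕ.≟ toℕ i ⌋ then c k else + 0)

  ⊛-coeff : ∀ a c i → _⊛_ N a c i ≡ Λ (shifted c i) a
  ⊛-coeff a c i = sum-cong (λ j →
    trans (sum-cong (λ k → if-mul ⌊ (toℕ j ℕ.+ toℕ k) ℕ.% N ℕ.≟ toℕ i ⌋ (a j) (c k)))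
          (sum-scale (a j) (λ k → if ⌊ (toℕ j ℕ.+ toℕ k) ℕ.% N ℕ.≟ toℕ i ⌋ then c k else + 0)))

  shifted-at : ∀ c i j k₀ → (toℕ j ℕ.+ toℕ k₀) ℕ.% N ≡ toℕ i →
               (∀ k → (toℕ j ℕ.+ toℕ k) ℕ.% N ≡ toℕ i → k ≡ k₀) → shifted c i j ≡ c k₀
  shifted-at c i j k₀ = sum-select (λ k → (toℕ j ℕ.+ toℕ k) ℕ.% N ℕ.≟ toℕ i) c k₀

  shifted-zero : ∀ c i → shifted c i ⟦ + 0 ⟧ ≡ c i
  shifted-zero c i = shifted-at c i ⟦ + 0 ⟧ i (plus-zero i)
                       (λ k eq → FinP.toℕ-injective (trans (sym (plus-zero k)) eq))
    where
    plus-zero : ∀ k → (toℕ ⟦ + 0 ⟧ ℕ.+ toℕ k) ℕ.% N ≡ toℕ k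
    plus-zero k rewrite toℕ-⟦⟧ (+ 0) = ℕD.m<n⇒m%n≡m (FinP.toℕ<n k)

  shifted-one : ∀ c i → shifted c i ⟦ + 1 ⟧ ≡ c (pred i)
  shifted-one c i = shifted-at c i ⟦ + 1 ⟧ (pred i) (trans (plus-one (pred i)) (suc-pred i))
                      (λ k eq → pred-unique k i (trans (sym (plus-one k)) eq))
    where
    plus-one : ∀ k → (toℕ ⟦ + 1 ⟧ ℕ.+ toℕ k) ℕ.% N ≡ suc (toℕ k) ℕ.% N
    plus-one k rewrite toℕ-⟦⟧ (+ 1) =
      sym (trans (ℕD.%-distribˡ-+ 1 (toℕ k) N)
                 (cong (λ x → (1 ℕ.% N ℕ.+ x) ℕ.% N) (ℕD.m<n⇒m%n≡m (FinP.toℕ<n k))))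

  ι-pointwise : ∀ c i → ι N c i ≡ c (pred i) - c i
  ι-pointwise c i = begin
      ι N c i                                                         ≡⟨ ⊛-coeff x-1 c i ⟩
      Λ (shifted c i) x-1
        ≡⟨ Λ-sub (shifted c i) (mono N (+ 1)) (mono N (+ 0)) ⟩
      Λ (shifted c i) (mono N (+ 1)) - Λ (shifted c i) (mono N (+ 0))
        ≡⟨ cong₂ _-_ (Λ-mono (shifted c i) (+ 1)) (Λ-mono (shifted c i) (+ 0)) ⟩
      shifted c i ⟦ + 1 ⟧ - shifted c i ⟦ + 0 ⟧
        ≡⟨ cong₂ _-_ (shifted-one c i) (shifted-zero c i) ⟩
      c (pred i) - c i                                                ∎
    where
    open ≡-Reasoning
    x-1 : R N
    x-1 = mono N (+ 1) ⊟ mono N (+ 0)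

  ι-resp : ∀ {a b} → a ≗ b → ι N a ≗ ι N b
  ι-resp {a} {b} a≗b i =
    trans (ι-pointwise a i) (trans (cong₂ _-_ (a≗b (pred i)) (a≗b i)) (sym (ι-pointwise b i)))

  ι-zero : ι N 𝟘 ≗ 𝟘
  ι-zero i = ι-pointwise 𝟘 i

  ι-add : ∀ a b → ι N (a ⊞ b) ≗ ι N a ⊞ ι N b
  ι-add a b i = trans (ι-pointwise (a ⊞ b) i)
    (trans (regroup (a (pred i)) (b (pred i)) (a i) (b i))
           (sym (cong₂ _+_ (ι-pointwise a i) (ι-pointwise b i))))
    where
    regroup : ∀ x y z w → (x + y) - (z + w) ≡ (x - z) + (y - w)
    regroup = solve-∀

  ι-sub : ∀ a b → ι N (a ⊟ b) ≗ ι N a ⊟ ι N b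
  ι-sub a b i = trans (ι-pointwise (a ⊟ b) i)
    (trans (regroup (a (pred i)) (b (pred i)) (a i) (b i))
           (sym (cong₂ _-_ (ι-pointwise a i) (ι-pointwise b i))))
    where
    regroup : ∀ x y z w → (x - y) - (z - w) ≡ (x - z) - (y - w)
    regroup = solve-∀

  ι-scale : ∀ z a → ι N (z ⊡ a) ≗ z ⊡ ι N a
  ι-scale z a i = trans (ι-pointwise (z ⊡ a) i)
    (trans (distrib z (a (pred i)) (a i)) (sym (cong (z ·_) (ι-pointwise a i))))
    where
    distrib : ∀ z x y → z · x - z · y ≡ z · (x - y)
    distrib = solve-∀

  ι-mono : ∀ t → ι N (mono N t) ≗ mono N (t + + 1) ⊟ mono N t
  ι-mono t i = trans (ι-pointwise (mono N t) i) (cong (_- mono N t i) (sym (mono-succ t i)))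

  ι-telescope : ∀ (h u : ℕ → R N) → (∀ j → ι N (h j) ≗ u (suc j) ⊟ u j) →
                ∀ t → ι N (sumR N t h) ≗ u t ⊟ u 0
  ι-telescope h u step zero i = trans (ι-zero i) (sym (ℤP.+-inverseʳ (u 0 i)))
  ι-telescope h u step (suc t) i =
    trans (ι-add (sumR N t h) (h t) i)
      (trans (cong₂ _+_ (ι-telescope h u step t i) (step t i))
             (collapse (u t i) (u 0 i) (u (suc t) i)))
    where
    collapse : ∀ x y z → (x - y) + (z - x) ≡ z - y
    collapse = solve-∀

  ι-geometric : ∀ B K → ι N (sumR N K (λ j → mono N (B + + j))) ≗ mono N (B + + K) ⊟ mono N B
  ι-geometric B K i =
    trans (ι-telescope (λ j → mono N (B + + j)) (λ j → mono N (B + + j)) step K i)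
          (cong (λ x → mono N (B + + K) i - mono N x i) (ℤP.+-identityʳ B))
    where
    step : ∀ j → ι N (mono N (B + + j)) ≗ mono N (B + + suc j) ⊟ mono N (B + + j)
    step j i = trans (ι-mono (B + + j) i) (cong (λ x → mono N x i - mono N (B + + j) i)
                                                (trans (ℤP.+-assoc B (+ j) (+ 1)) (cong (_+_ B) (sym (+suc j)))))

  lincomb-cong-coeff : ∀ g c c′ t → (∀ v → 1 ≤ v → v ≤ t → c v ≡ c′ v) →
                       lincomb N g c t ≗ lincomb N g c′ t
  lincomb-cong-coeff g c c′ zero _ i = refl
  lincomb-cong-coeff g c c′ (suc t) c≡c′ i =
    cong₂ _+_ (lincomb-cong-coeff g c c′ t (λ v 1≤v v≤t → c≡c′ v 1≤v (ℕP.m≤n⇒m≤1+n v≤t)) i)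
              (cong (_· g (+ suc t) i) (c≡c′ (suc t) (s≤s z≤n) ℕP.≤-refl))

  lincomb-cong-gen : ∀ g h c t → (∀ v → 1 ≤ v → v ≤ t → g (+ v) ≗ h (+ v)) →
                     lincomb N g c t ≗ lincomb N h c t
  lincomb-cong-gen g h c zero _ i = refl
  lincomb-cong-gen g h c (suc t) g≗h i =
    cong₂ _+_ (lincomb-cong-gen g h c t (λ v 1≤v v≤t → g≗h v 1≤v (ℕP.m≤n⇒m≤1+n v≤t)) i)
              (cong (c (suc t) ·_) (g≗h (suc t) (s≤s z≤n) ℕP.≤-refl i))

  lincomb-zero : ∀ g t → lincomb N g (λ _ → + 0) t ≗ 𝟘
  lincomb-zero g zero i = refl
  lincomb-zero g (suc t) i = trans (ℤP.+-identityʳ _) (lincomb-zero g t i)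

  lincomb-add : ∀ g c c′ t → lincomb N g (λ v → c v + c′ v) t ≗ lincomb N g c t ⊞ lincomb N g c′ t
  lincomb-add g c c′ zero i = refl
  lincomb-add g c c′ (suc t) i =
    trans (cong (_+ (c (suc t) + c′ (suc t)) · g (+ suc t) i) (lincomb-add g c c′ t i))
          (regroup (lincomb N g c t i) (lincomb N g c′ t i) (c (suc t)) (c′ (suc t)) (g (+ suc t) i))
    where
    regroup : ∀ a b x y z → (a + b) + (x + y) · z ≡ (a + x · z) + (b + y · z)
    regroup = solve-∀

  lincomb-sub : ∀ g c c′ t → lincomb N g (λ v → c v - c′ v) t ≗ lincomb N g c t ⊟ lincomb N g c′ t
  lincomb-sub g c c′ zero i = refl
  lincomb-sub g c c′ (suc t) i =
    trans (cong (_+ (c (suc t) - c′ (suc t)) · g (+ suc t) i) (lincomb-sub g c c′ t i))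
          (regroup (lincomb N g c t i) (lincomb N g c′ t i) (c (suc t)) (c′ (suc t)) (g (+ suc t) i))
    where
    regroup : ∀ a b x y z → (a - b) + (x - y) · z ≡ (a + x · z) - (b + y · z)
    regroup = solve-∀

  lincomb-scale : ∀ g z c t → lincomb N g (λ v → z · c v) t ≗ z ⊡ lincomb N g c t
  lincomb-scale g z c zero i = sym (ℤP.*-zeroʳ z)
  lincomb-scale g z c (suc t) i =
    trans (cong (_+ (z · c (suc t)) · g (+ suc t) i) (lincomb-scale g z c t i))
          (distrib z (lincomb N g c t i) (c (suc t)) (g (+ suc t) i))
    where
    distrib : ∀ z a x y → z · a + (z · x) · y ≡ z · (a + x · y)
    distrib = solve-∀

  unit : ℕ → ℕ → ℤ
  unit v u = if ⌊ u ℕ.≟ v ⌋ then + 1 else + 0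

  unit-same : ∀ v → unit v v ≡ + 1
  unit-same v with v ℕ.≟ v
  ... | yes _ = refl
  ... | no v≢v = ⊥-elim (v≢v refl)

  unit-other : ∀ v u → u ≢ v → unit v u ≡ + 0
  unit-other v u u≢v with u ℕ.≟ v
  ... | yes u≡v = ⊥-elim (u≢v u≡v)
  ... | no _ = refl

  lincomb-unit : ∀ g v t → 1 ≤ v → v ≤ t → lincomb N g (unit v) t ≗ g (+ v)
  lincomb-unit g v zero 1≤v v≤0 i = ⊥-elim (ℕP.<-irrefl refl (ℕP.≤-trans 1≤v v≤0))
  lincomb-unit g v (suc t) 1≤v v≤t+1 i with v ℕ.≟ suc t
  ... | yes refl =
    trans (cong₂ _+_ (trans (lincomb-cong-coeff g (unit v) (λ _ → + 0) t
                               (λ u _ u≤t → unit-other v u (λ u≡v → ℕP.<-irrefl u≡v (s≤s u≤t))) i)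
                            (lincomb-zero g t i))
                     (cong (_· g (+ v) i) (unit-same v)))
          (trans (ℤP.+-identityˡ _) (ℤP.*-identityˡ _))
  ... | no v≢t+1 =
    trans (cong₂ _+_ (lincomb-unit g v t 1≤v (ℕP.≤-pred (ℕP.≤∧≢⇒< v≤t+1 v≢t+1)) i)
                     (cong (_· g (+ suc t) i) (unit-other v (suc t) (λ eq → v≢t+1 (sym eq)))))
          (ℤP.+-identityʳ _)

  ι-lincomb : ∀ g c t → ι N (lincomb N g c t) ≗ lincomb N (λ z → ι N (g z)) c t
  ι-lincomb g c zero = ι-zero
  ι-lincomb g c (suc t) i =
    trans (ι-add (lincomb N g c t) (c (suc t) ⊡ g (+ suc t)) i)
          (cong₂ _+_ (ι-lincomb g c t i) (ι-scale (c (suc t)) (g (+ suc t)) i))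

  span-resp : ∀ {g a b} → a ≗ b → InSpan N g a → InSpan N g b
  span-resp a≗b (c , a≗lc) = c , λ i → trans (sym (a≗b i)) (a≗lc i)

  span-zero : ∀ {g} → InSpan N g 𝟘
  span-zero {g} = (λ _ → + 0) , λ i → sym (lincomb-zero g m i)

  span-add : ∀ {g a b} → InSpan N g a → InSpan N g b → InSpan N g (a ⊞ b)
  span-add {g} (c , a≗) (c′ , b≗) =
    (λ v → c v + c′ v) , λ i → trans (cong₂ _+_ (a≗ i) (b≗ i)) (sym (lincomb-add g c c′ m i))

  span-sub : ∀ {g a b} → InSpan N g a → InSpan N g b → InSpan N g (a ⊟ b)
  span-sub {g} (c , a≗) (c′ , b≗) =
    (λ v → c v - c′ v) , λ i → trans (cong₂ _-_ (a≗ i) (b≗ i)) (sym (lincomb-sub g c c′ m i))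

  span-scale : ∀ {g a} z → InSpan N g a → InSpan N g (z ⊡ a)
  span-scale {g} z (c , a≗) =
    (λ v → z · c v) , λ i → trans (cong (z ·_) (a≗ i)) (sym (lincomb-scale g z c m i))

  span-gen : ∀ {g} v → 1 ≤ v → v ≤ m → InSpan N g (g (+ v))
  span-gen {g} v 1≤v v≤m = unit v , λ i → sym (lincomb-unit g v m 1≤v v≤m i)

  span-sumR : ∀ {g} t (h : ℕ → R N) → (∀ j → j < t → InSpan N g (h j)) → InSpan N g (sumR N t h)
  span-sumR zero h _ = span-zero
  span-sumR (suc t) h h∈ =
    span-add (span-sumR t h (λ j j<t → h∈ j (ℕP.m≤n⇒m≤1+n j<t))) (h∈ t ℕP.≤-refl)

  span-gen≤N : ∀ {g} → g (+ 0) ≗ 𝟘 → g (+ N) ≗ 𝟘 → ∀ w → w ≤ N → InSpan N g (g (+ w))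
  span-gen≤N g0 gN zero _ = span-resp (≗-sym g0) span-zero
  span-gen≤N g0 gN (suc w) w<N with suc w ℕ.≟ N
  ... | yes refl = span-resp (≗-sym gN) span-zero
  ... | no w≢N = span-gen (suc w) (s≤s z≤n) (ℕP.≤-pred (ℕP.≤∧≢⇒< w<N w≢N))

  span-lincomb : ∀ {h g} → (∀ v → 1 ≤ v → v ≤ m → InSpan N h (g (+ v))) →
                 ∀ c t → t ≤ m → InSpan N h (lincomb N g c t)
  span-lincomb gens c zero _ = span-zero
  span-lincomb gens c (suc t) t<m =
    span-add (span-lincomb gens c t (ℕP.<⇒≤ t<m)) (span-scale (c (suc t)) (gens (suc t) (s≤s z≤n) t<m))

  span-ι : ∀ {h g a} → (∀ v → 1 ≤ v → v ≤ m → InSpan N h (ι N (g (+ v)))) →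
           InSpan N g a → InSpan N h (ι N a)
  span-ι {g = g} gens (c , a≗) =
    span-resp (≗-sym (≗-trans (ι-resp a≗) (ι-lincomb g c m))) (span-lincomb gens c m ℕP.≤-refl)

  Λ-lincomb-∣ : ∀ k w g c t → (∀ v → 1 ≤ v → v ≤ t → k ∣ Λ w (g (+ v))) →
                k ∣ Λ w (lincomb N g c t)
  Λ-lincomb-∣ k w g c zero _ = subst (k ∣_) (sym (Λ-zero w)) (divides (+ 0) refl)
  Λ-lincomb-∣ k w g c (suc t) gens =
    subst (k ∣_) (sym (trans (Λ-add w (lincomb N g c t) (c (suc t) ⊡ g (+ suc t)))
                            (cong (_+_ (Λ w (lincomb N g c t))) (Λ-scale w (c (suc t)) (g (+ suc t))))))
      (∣m∣n⇒∣m+n (Λ-lincomb-∣ k w g c t (λ v 1≤v v≤t → gens v 1≤v (ℕP.m≤n⇒m≤1+n v≤t)))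
                  (∣n⇒∣m*n (c (suc t)) (gens (suc t) (s≤s z≤n) ℕP.≤-refl)))

  Λ-span-∣ : ∀ k w g {a} → (∀ v → 1 ≤ v → v ≤ m → k ∣ Λ w (g (+ v))) → InSpan N g a → k ∣ Λ w a
  Λ-span-∣ k w g gens (c , a≗) = subst (k ∣_) (sym (Λ-resp w a≗)) (Λ-lincomb-∣ k w g c m gens)

  _∼⟨_⟩_ : R N → (ℤ → R N) → R N → Set
  a ∼⟨ g ⟩ b = InSpan N g (a ⊟ b)

  ∼-sym : ∀ {g a b} → a ∼⟨ g ⟩ b → b ∼⟨ g ⟩ a
  ∼-sym {g} {a} {b} a∼b = span-resp (λ i → flip (a i) (b i)) (span-sub {g} {𝟘} {a ⊟ b} span-zero a∼b)
    where
    flip : ∀ x y → + 0 - (x - y) ≡ y - x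
    flip = solve-∀

  ∼-trans : ∀ {g a b c} → a ∼⟨ g ⟩ b → b ∼⟨ g ⟩ c → a ∼⟨ g ⟩ c
  ∼-trans {g} {a} {b} {c} a∼b b∼c =
    span-resp (λ i → chain (a i) (b i) (c i)) (span-add {g} {a ⊟ b} {b ⊟ c} a∼b b∼c)
    where
    chain : ∀ x y z → (x - y) + (y - z) ≡ x - z
    chain = solve-∀

  size-≤ : ∀ g {k k′} → HasSize N (_∼⟨ g ⟩_) k → HasSize N (_∼⟨ g ⟩_) k′ → k ≤ k′
  size-≤ g {k} {k′} (s , s∈ , _ , s-inj) (s′ , _ , s′-cover , _) =
    FinP.injective⇒≤ {f = class} class-injective
    where
    class : Fin k → Fin k′
    class j = proj₁ (s′-cover (s j) (s∈ j))
    class-injective : ∀ {a b} → class a ≡ class b → a ≡ b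
    class-injective {a} {b} eq = s-inj a b
      (∼-trans {g} {s a} {s′ (class a)} {s b} (proj₂ (s′-cover (s a) (s∈ a)))
        (∼-sym {g} {s b} {s′ (class a)}
          (subst (λ j → s b ∼⟨ g ⟩ s′ j) (sym eq) (proj₂ (s′-cover (s b) (s∈ b))))))

  size-unique : ∀ g {k k′} → HasSize N (_∼⟨ g ⟩_) k → HasSize N (_∼⟨ g ⟩_) k′ → k ≡ k′
  size-unique g h h′ = ℕP.≤-antisym (size-≤ g h h′) (size-≤ g h′ h)

  e-vanishes : ∀ t → t ≋ + 0 → e N t ≗ 𝟘
  e-vanishes t t≋0 i =
    trans (cong (_- mono N (+ 0) i) (mono-periodic t (+ 0) t≋0 i)) (ℤP.+-inverseʳ (mono N (+ 0) i))

  ε-vanishes : ∀ d t → t ≋ + 0 → ε N d t ≗ 𝟘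
  ε-vanishes d t t≋0 i =
    trans (cong₂ (λ x y → d · x - y) (e-vanishes t t≋0 i) (e-vanishes (d · t) dt≋0 i))
          (cong (_- + 0) (ℤP.*-zeroʳ d))
    where
    dt≋0 : d · t ≋ + 0
    dt≋0 = ≋-trans (·-congˡ-≋ d t≋0) (≋-reflexive (ℤP.*-zeroʳ d))

  N≋0 : + N ≋ + 0
  N≋0 = subst (_≋ + 0) (ℤP.*-identityˡ (+ N)) (multiple≋0 (+ 1))

  e-in-Zn : ∀ w → w ≤ N → Zn N (e N (+ w))
  e-in-Zn = span-gen≤N (e-vanishes (+ 0) ≋-refl) (e-vanishes (+ N) N≋0)

  ε-in-ℰ : ∀ d w → w ≤ N → InSpan N (ε N d) (ε N d (+ w))
  ε-in-ℰ d = span-gen≤N (ε-vanishes d (+ 0) ≋-refl) (ε-vanishes d (+ N) N≋0)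

  ι-e : ∀ t → ι N (e N t) ≗ (e N (t + + 1) ⊟ e N t) ⊟ e N (+ 1)
  ι-e t i = trans (ι-sub (mono N t) (mono N (+ 0)) i)
    (trans (cong₂ _-_ (ι-mono t i) (ι-mono (+ 0) i))
           (regroup (mono N (t + + 1) i) (mono N t i) (mono N (+ 1) i) (mono N (+ 0) i)))
    where
    regroup : ∀ a b c z → (a - b) - (c - z) ≡ ((a - z) - (b - z)) - (c - z)
    regroup = solve-∀

  ι-preserves-Zn : ∀ {c} → Zn N c → Zn N (ι N c)
  ι-preserves-Zn = span-ι λ v _ v≤m → span-resp (≗-sym (ι-e (+ v)))
    (span-sub (span-sub (subst (λ x → Zn N (e N x)) (+suc v) (e-in-Zn (suc v) (s≤s v≤m)))
                        (e-in-Zn v (ℕP.m≤n⇒m≤1+n v≤m)))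
              (e-in-Zn 1 (s≤s z≤n)))

  ε-step : ∀ d t → ε N d (t + + 1) ⊟ ε N d t
                   ≗ d ⊡ (mono N (t + + 1) ⊟ mono N t) ⊟ (mono N (d · (t + + 1)) ⊟ mono N (d · t))
  ε-step d t i =
    regroup d (mono N (t + + 1) i) (mono N t i) (mono N (d · (t + + 1)) i) (mono N (d · t) i) (mono N (+ 0) i)
    where
    regroup : ∀ d A B C D Z → (d · (A - Z) - (C - Z)) - (d · (B - Z) - (D - Z)) ≡ d · (A - B) - (C - D)
    regroup = solve-∀

  -- ι f_v = ε_{v+1} − ε_v for every d: for d = K ≥ 0 the sum in f_v telescopes to
  -- x^{K(v+1)} − x^{Kv}, for d = −S < 0 to x^{dv} − x^{d(v+1)}
  ι-f : ∀ d v → ι N (f N d (+ v)) ≗ ε N d (+ suc v) ⊟ ε N d (+ v)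
  ι-f d v i = trans (ι-f-expanded d i)
    (trans (sym (ε-step d (+ v) i)) (cong (λ x → ε N d x i - ε N d (+ v) i) (sym (+suc v))))
    where
    t : ℤ
    t = + v
    ι-f-expanded : ∀ d → ι N (f N d t)
                         ≗ d ⊡ (mono N (t + + 1) ⊟ mono N t) ⊟ (mono N (d · (t + + 1)) ⊟ mono N (d · t))
    ι-f-expanded (+ K) i =
      trans (ι-sub (+ K ⊡ mono N t) (sumR N K (λ j → mono N (+ K · t + + j))) i)
        (cong₂ _-_ (trans (ι-scale (+ K) (mono N t) i) (cong (+ K ·_) (ι-mono t i)))
               (trans (ι-geometric (+ K · t) K i)
                      (cong (λ x → mono N x i - mono N (+ K · t) i) (add-step (+ K) t))))
      where
      add-step : ∀ K t → K · t + K ≡ K · (t + + 1)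
      add-step = solve-∀
    ι-f-expanded d@(-[1+ k ]) i =
      trans (ι-add (d ⊡ mono N t) (sumR N (suc k) (λ j → mono N (d · (t + + 1) + + j))) i)
        (trans (cong₂ _+_ (trans (ι-scale d (mono N t) i) (cong (d ·_) (ι-mono t i)))
                          (trans (ι-geometric (d · (t + + 1)) (suc k) i)
                                 (cong (λ x → mono N x i - mono N (d · (t + + 1)) i) (sub-step (+ suc k) t))))
               (reorder d (mono N (t + + 1) i) (mono N t i) (mono N (d · t) i) (mono N (d · (t + + 1)) i)))
      where
      sub-step : ∀ S t → (- S) · (t + + 1) + S ≡ (- S) · t
      sub-step = solve-∀
      reorder : ∀ d A B C D → d · (A - B) + (C - D) ≡ d · (A - B) - (D - C)
      reorder = solve-∀

  ι-maps-F-to-ℰ : ∀ d {c} → InSpan N (f N d) c → InSpan N (ε N d) (ι N c)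
  ι-maps-F-to-ℰ d = span-ι λ v _ v≤m → span-resp (≗-sym (ι-f d v))
    (span-sub (ε-in-ℰ d (suc v) (s≤s v≤m)) (ε-in-ℰ d v (ℕP.m≤n⇒m≤1+n v≤m)))

  one : Fin N → ℤ
  one _ = + 1

  index : Fin N → ℤ
  index i = + toℕ i

  aug : R N → ℤ
  aug = Λ one

  φ : R N → ℤ
  φ = Λ index

  aug-e : ∀ t → aug (e N t) ≡ + 0
  aug-e t = trans (Λ-sub one (mono N t) (mono N (+ 0))) (cong₂ _-_ (Λ-mono one t) (Λ-mono one (+ 0)))

  aug-Zn : ∀ {a} → Zn N a → aug a ≡ + 0
  aug-Zn a∈Zn = 0∣⇒≡0 (Λ-span-∣ (+ 0) one (e N) (λ v _ _ → divides (+ 0) (aug-e (+ v))) a∈Zn)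

  aug-monomials : ∀ K (t : ℕ → ℤ) → aug (sumR N K (λ j → mono N (t j))) ≡ + K
  aug-monomials zero t = Λ-zero one
  aug-monomials (suc K) t =
    trans (Λ-add one (sumR N K (λ j → mono N (t j))) (mono N (t K)))
          (trans (cong₂ _+_ (aug-monomials K t) (Λ-mono one (t K))) (sym (+suc K)))

  aug-f : ∀ d v → aug (f N d (+ v)) ≡ + 0
  aug-f (+ K) v = trans (Λ-sub one (+ K ⊡ mono N (+ v)) (sumR N K (λ j → mono N (+ K · + v + + j))))
    (trans (cong₂ _-_ (trans (Λ-scale one (+ K) (mono N (+ v))) (cong (+ K ·_) (Λ-mono one (+ v))))
                      (aug-monomials K (λ j → + K · + v + + j)))
           (trans (cong (_- + K) (ℤP.*-identityʳ (+ K))) (ℤP.+-inverseʳ (+ K))))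
  aug-f -[1+ k ] v =
    trans (Λ-add one (-[1+ k ] ⊡ mono N (+ v)) (sumR N (suc k) (λ j → mono N (-[1+ k ] · (+ v + + 1) + + j))))
    (trans (cong₂ _+_ (trans (Λ-scale one -[1+ k ] (mono N (+ v))) (cong (-[1+ k ] ·_) (Λ-mono one (+ v))))
                      (aug-monomials (suc k) (λ j → -[1+ k ] · (+ v + + 1) + + j)))
           (trans (cong (_+ + suc k) (ℤP.*-identityʳ -[1+ k ])) (ℤP.+-inverseˡ (+ suc k))))

  aug-F : ∀ d {b} → InSpan N (f N d) b → aug b ≡ + 0
  aug-F d b∈F = 0∣⇒≡0 (Λ-span-∣ (+ 0) one (f N d) (λ v _ _ → divides (+ 0) (aug-f d v)) b∈F)

  φ-mono : ∀ t → φ (mono N t) ≋ t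
  φ-mono t = subst (_≋ t) (sym (trans (Λ-mono index t) (cong +_ (toℕ-⟦⟧ t)))) (≋-sym (≋-residue t))

  φ-e : ∀ t → φ (e N t) ≋ t
  φ-e t = begin
      φ (e N t)                          ≡⟨ Λ-sub index (mono N t) (mono N (+ 0)) ⟩
      φ (mono N t) - φ (mono N (+ 0))    ≈⟨ -‿cong-≋ (φ-mono t) (φ-mono (+ 0)) ⟩
      t - + 0                            ≡⟨ ℤP.+-identityʳ t ⟩
      t                                  ∎
    where open ≋-Reasoning

  φ-multiple-e₁ : ∀ k → φ (k ⊡ e N (+ 1)) ≋ k
  φ-multiple-e₁ k = begin
      φ (k ⊡ e N (+ 1))  ≡⟨ Λ-scale index k (e N (+ 1)) ⟩
      k · φ (e N (+ 1))  ≈⟨ ·-congˡ-≋ k (φ-e (+ 1)) ⟩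
      k · + 1            ≡⟨ ℤP.*-identityʳ k ⟩
      k                  ∎
    where open ≋-Reasoning

  φ-ε : ∀ d t → φ (ε N d t) ≋ + 0
  φ-ε d t = begin
      φ (ε N d t)                           ≡⟨ Λ-sub index (d ⊡ e N t) (e N (d · t)) ⟩
      φ (d ⊡ e N t) - φ (e N (d · t))       ≡⟨ cong (_- φ (e N (d · t))) (Λ-scale index d (e N t)) ⟩
      d · φ (e N t) - φ (e N (d · t))       ≈⟨ -‿cong-≋ (·-congˡ-≋ d (φ-e t)) (φ-e (d · t)) ⟩
      d · t - d · t                         ≡⟨ ℤP.+-inverseʳ (d · t) ⟩
      + 0                                   ∎
    where open ≋-Reasoning

  φ-ℰ : ∀ d {a} → InSpan N (ε N d) a → φ a ≋ + 0
  φ-ℰ d a∈ℰ = ∣⇒≋0 (Λ-span-∣ (+ N) index (ε N d) (λ v _ _ → ≋0⇒∣ (φ-ε d (+ v))) a∈ℰ)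

  φ-ι-e : ∀ t → φ (ι N (e N t)) ≋ + 0
  φ-ι-e t = begin
      φ (ι N (e N t))                                          ≡⟨ Λ-resp index (ι-e t) ⟩
      φ ((e N (t + + 1) ⊟ e N t) ⊟ e N (+ 1))
        ≡⟨ trans (Λ-sub index (e N (t + + 1) ⊟ e N t) (e N (+ 1)))
                 (cong (_- φ (e N (+ 1))) (Λ-sub index (e N (t + + 1)) (e N t))) ⟩
      (φ (e N (t + + 1)) - φ (e N t)) - φ (e N (+ 1))
        ≈⟨ -‿cong-≋ (-‿cong-≋ (φ-e (t + + 1)) (φ-e t)) (φ-e (+ 1)) ⟩
      ((t + + 1) - t) - + 1                                    ≡⟨ cancel t ⟩
      + 0                                                      ∎
    where
    open ≋-Reasoning
    cancel : ∀ t → ((t + + 1) - t) - + 1 ≡ + 0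
    cancel = solve-∀

  φ-ι : ∀ {c} → Zn N c → φ (ι N c) ≋ + 0
  φ-ι (a , c≗) = ∣⇒≋0 (subst (+ N ∣_) (sym (Λ-resp index (≗-trans (ι-resp c≗) (ι-lincomb (e N) a m))))
    (Λ-lincomb-∣ (+ N) index (λ z → ι N (e N z)) a m (λ v _ _ → ≋0⇒∣ (φ-ι-e (+ v)))))

  -- With P_v = e_0 + … + e_{v−1} we have ι P_v = e_v − v·e_1;
  -- replacing e_v by P_v in s = Σ a_v e_v gives ι(Σ a_v P_v) = s − W·e_1 with W = Σ v·a_v,
  -- and W ≡ φ s ≡ 0, so W = q·N and ι P_N = −N·e_1 corrects the remainder.
  partialSum : ℕ → R N
  partialSum v = sumR N v (λ j → e N (+ j))

  partialSum-in-Zn : ∀ v → v ≤ N → Zn N (partialSum v)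
  partialSum-in-Zn v v≤N =
    span-sumR v (λ j → e N (+ j)) (λ j j<v → e-in-Zn j (ℕP.≤-trans (ℕP.<⇒≤ j<v) v≤N))

  ι-partialSum : ∀ v → ι N (partialSum v) ≗ e N (+ v) ⊟ (+ v) ⊡ e N (+ 1)
  ι-partialSum v i =
    trans (ι-telescope (λ j → e N (+ j)) u step v i)
          (start-vanishes (e N (+ v) i) (+ v) (e N (+ 1) i) (mono N (+ 0) i))
    where
    u : ℕ → R N
    u j = e N (+ j) ⊟ (+ j) ⊡ e N (+ 1)
    step : ∀ j → ι N (e N (+ j)) ≗ u (suc j) ⊟ u j
    step j i = trans (ι-e (+ j) i)
      (trans (cong (λ x → (e N x i - e N (+ j) i) - e N (+ 1) i) (sym (+suc j)))
             (trans (regroup (e N (+ suc j) i) (e N (+ j) i) (e N (+ 1) i) (+ j))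
                    (cong (λ x → (e N (+ suc j) i - x · e N (+ 1) i) - u j i) (sym (+suc j)))))
      where
      regroup : ∀ a b e₁ j → (a - b) - e₁ ≡ (a - (j + + 1) · e₁) - (b - j · e₁)
      regroup = solve-∀
    start-vanishes : ∀ a v e₁ z → (a - v · e₁) - ((z - z) - + 0 · e₁) ≡ a - v · e₁
    start-vanishes = solve-∀

  weight : (ℕ → ℤ) → ℕ → ℤ
  weight a zero = + 0
  weight a (suc t) = weight a t + a (suc t) · + suc t

  ι-lift : ∀ a t → ι N (lincomb N (λ z → partialSum ∣ z ∣) a t)
                   ≗ lincomb N (e N) a t ⊟ weight a t ⊡ e N (+ 1)
  ι-lift a zero i = trans (ι-zero i) (sym (vanish (e N (+ 1) i)))
    where
    vanish : ∀ x → + 0 - + 0 · x ≡ + 0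
    vanish = solve-∀
  ι-lift a (suc t) i =
    trans (ι-add (lincomb N (λ z → partialSum ∣ z ∣) a t) (a (suc t) ⊡ partialSum (suc t)) i)
      (trans (cong₂ (λ x y → x + y) (ι-lift a t i) (trans (ι-scale (a (suc t)) (partialSum (suc t)) i)
                                                          (cong (a (suc t) ·_) (ι-partialSum (suc t) i))))
             (regroup (lincomb N (e N) a t i) (weight a t) (e N (+ 1) i) (a (suc t)) (e N (+ suc t) i) (+ suc t)))
    where
    regroup : ∀ L W E c b v → (L - W · E) + c · (b - v · E) ≡ (L + c · b) - (W + c · v) · E
    regroup = solve-∀


  ι-image : ∀ s → Zn N s → φ s ≋ + 0 → Σ[ c ∈ R N ] (Zn N c × (ι N c ≗ s))
  ι-image s (a , s≗) φs≋0 = X ⊟ q ⊡ partialSum N , c∈Zn , ιc≗s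
    where
    X : R N
    X = lincomb N (λ z → partialSum ∣ z ∣) a m
    X∈Zn : Zn N X
    X∈Zn = span-lincomb (λ v _ v≤m → partialSum-in-Zn v (ℕP.m≤n⇒m≤1+n v≤m)) a m ℕP.≤-refl
    W : ℤ
    W = weight a m
    ιX≗ : ι N X ≗ s ⊟ W ⊡ e N (+ 1)
    ιX≗ i = trans (ι-lift a m i) (cong (_- W · e N (+ 1) i) (sym (s≗ i)))
    φs≋φWe₁ : φ s ≋ φ (W ⊡ e N (+ 1))
    φs≋φWe₁ = ≋0⇒≋ (subst (_≋ + 0) (trans (Λ-resp index ιX≗) (Λ-sub index s (W ⊡ e N (+ 1))))
                          (φ-ι X∈Zn))
    N∣W : + N ∣ W
    N∣W = ≋0⇒∣ (≋-trans (≋-sym (φ-multiple-e₁ W)) (≋-trans (≋-sym φs≋φWe₁) φs≋0))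
    q : ℤ
    q = _∣_.quotient N∣W
    c∈Zn : Zn N (X ⊟ q ⊡ partialSum N)
    c∈Zn = span-sub X∈Zn (span-scale q (partialSum-in-Zn N ℕP.≤-refl))
    ιc≗s : ι N (X ⊟ q ⊡ partialSum N) ≗ s
    ιc≗s i = begin
        ι N (X ⊟ q ⊡ partialSum N) i                              ≡⟨ ι-sub X (q ⊡ partialSum N) i ⟩
        ι N X i - ι N (q ⊡ partialSum N) i
          ≡⟨ cong₂ _-_ (ιX≗ i) (trans (ι-scale q (partialSum N) i) (cong (q ·_) (ι-partialSum N i))) ⟩
        (s i - W · E) - q · (e N (+ N) i - + N · E)
          ≡⟨ cong₂ (λ w z → (s i - w · E) - q · (z - + N · E))
                   (_∣_.equality N∣W) (e-vanishes (+ N) N≋0 i) ⟩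
        (s i - (q · + N) · E) - q · (+ 0 - + N · E)              ≡⟨ cancel (s i) q (+ N) E ⟩
        s i                                                       ∎
      where
      open ≡-Reasoning
      E : ℤ
      E = e N (+ 1) i
      cancel : ∀ s q n E → (s - (q · n) · E) - q · (+ 0 - n · E) ≡ s
      cancel = solve-∀

  -- G_v = −(f_v + f_{v+1} + … + f_{N−1}) satisfies ι G_v = ε_v since
  -- ε_N = 0, so for ι c = Σ a_v ε_v the element b = Σ a_v G_v ∈ ⟨f⟩ has ι b = ι c.  Then c − b
  -- lies in the kernel of ι, so it is constant, and has augmentation 0, so it vanishes.
  module _ (d : ℤ) where
    tailTerms : ℕ → ℕ → R N
    tailTerms v j = f N d (+ (j ℕ.+ v))

    tailSum : ℕ → R N
    tailSum v = 𝟘 ⊟ sumR N (N ∸ v) (tailTerms v)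

    ι-tailSum : ∀ v → v ≤ N → ι N (tailSum v) ≗ ε N d (+ v)
    ι-tailSum v v≤N i = begin
        ι N (tailSum v) i                                  ≡⟨ ι-sub 𝟘 (sumR N (N ∸ v) (tailTerms v)) i ⟩
        ι N 𝟘 i - ι N (sumR N (N ∸ v) (tailTerms v)) i
          ≡⟨ cong₂ _-_ (ι-zero i) (ι-telescope (tailTerms v) (λ j → ε N d (+ (j ℕ.+ v)))
                                               (λ j → ι-f d (j ℕ.+ v)) (N ∸ v) i) ⟩
        + 0 - (ε N d (+ (N ∸ v ℕ.+ v)) i - ε N d (+ v) i)
          ≡⟨ cong (λ x → + 0 - (ε N d (+ x) i - ε N d (+ v) i)) (ℕP.m∸n+n≡m v≤N) ⟩
        + 0 - (ε N d (+ N) i - ε N d (+ v) i)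
          ≡⟨ cong (λ x → + 0 - (x - ε N d (+ v) i)) (ε-vanishes d (+ N) N≋0 i) ⟩
        + 0 - (+ 0 - ε N d (+ v) i)                        ≡⟨ double-negation (ε N d (+ v) i) ⟩
        ε N d (+ v) i                                      ∎
      where
      open ≡-Reasoning
      double-negation : ∀ x → + 0 - (+ 0 - x) ≡ x
      double-negation = solve-∀

    tailSum-in-F : ∀ v → 1 ≤ v → v ≤ N → InSpan N (f N d) (tailSum v)
    tailSum-in-F v 1≤v v≤N = span-sub span-zero (span-sumR (N ∸ v) (tailTerms v) λ j j<N∸v →
      span-gen (j ℕ.+ v) (ℕP.≤-trans 1≤v (ℕP.m≤n+m v j))
                         (ℕP.≤-pred (ℕP.m≤o∸n⇒m+n≤o (suc j) v≤N j<N∸v)))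

  ι-kernel-constant : ∀ x → ι N x ≗ 𝟘 → ∀ i → x i ≡ x zero
  ι-kernel-constant x ιx≗0 i = along (toℕ i) i refl
    where
    step : ∀ i → x (pred i) ≡ x i
    step i = ℤP.i-j≡0⇒i≡j _ _ (trans (sym (ι-pointwise x i)) (ιx≗0 i))
    along : ∀ t (i : Fin N) → toℕ i ≡ t → x i ≡ x zero
    along zero zero _ = refl
    along (suc t) (suc j) eq =
      trans (sym (step (suc j))) (along t (inject₁ j) (trans (FinP.toℕ-inject₁ j) (ℕP.suc-injective eq)))
    along zero (suc _) ()
    along (suc _) zero ()

  aug-constant : ∀ x → (∀ i → x i ≡ x zero) → aug x ≡ + N · x zero
  aug-constant x constant =
    trans (sum-cong (λ i → trans (ℤP.*-identityʳ (x i)) (constant i))) (sum-const {N} (x zero))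

  kernel-lemma : ∀ d {c} → Zn N c → InSpan N (ε N d) (ι N c) → InSpan N (f N d) c
  kernel-lemma d {c} c∈Zn (a , ιc≗) = span-resp (λ i → sym (c≡b i)) b∈F
    where
    b : R N
    b = lincomb N (λ z → tailSum d ∣ z ∣) a m
    b∈F : InSpan N (f N d) b
    b∈F = span-lincomb (λ v 1≤v v≤m → tailSum-in-F d v 1≤v (ℕP.m≤n⇒m≤1+n v≤m)) a m ℕP.≤-refl
    ιb≗ιc : ι N b ≗ ι N c
    ιb≗ιc = ≗-trans (ι-lincomb (λ z → tailSum d ∣ z ∣) a m)
      (≗-trans (lincomb-cong-gen (λ z → ι N (tailSum d ∣ z ∣)) (ε N d) a m
                                 (λ v _ v≤m → ι-tailSum d v (ℕP.m≤n⇒m≤1+n v≤m)))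
               (≗-sym ιc≗))
    x : R N
    x = c ⊟ b
    x-constant : ∀ i → x i ≡ x zero
    x-constant = ι-kernel-constant x λ i →
      trans (ι-sub c b i) (trans (cong (_-_ (ι N c i)) (ιb≗ιc i)) (ℤP.+-inverseʳ (ι N c i)))
    x₀≡0 : x zero ≡ + 0
    x₀≡0 = ℤP.*-cancelˡ-≡ (+ N) (x zero) (+ 0) (begin
        + N · x zero   ≡⟨ sym (aug-constant x x-constant) ⟩
        aug x          ≡⟨ Λ-sub one c b ⟩
        aug c - aug b  ≡⟨ cong₂ _-_ (aug-Zn c∈Zn) (aug-F d b∈F) ⟩
        + 0            ≡⟨ sym (ℤP.*-zeroʳ (+ N)) ⟩
        + N · + 0      ∎)
      where open ≡-Reasoning
    c≡b : ∀ i → c i ≡ b i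
    c≡b i = ℤP.i-j≡0⇒i≡j (c i) (b i) (trans (x-constant i) x₀≡0)

  φ-respects-Σ : ∀ d a b → ≈Σ N d a b → φ a ≋ φ b
  φ-respects-Σ d a b a∼b = ≋0⇒≋ (subst (_≋ + 0) (Λ-sub index a b) (φ-ℰ d a∼b))

  quotient≅ℤ/N : ∀ d → QuotIsoZmod N (≈Q N d)
  quotient≅ℤ/N d = φ , (λ a b _ _ → ≋⇒∣ᵤ (≋-reflexive (Λ-add index a b))) , surjective ,
                   λ a b a∈Zn b∈Zn → mk⇔ (≈Q⇒≋ a b) (≋⇒≈Q a b a∈Zn b∈Zn)
    where
    surjective : ∀ k → Σ[ a ∈ R N ] (Zn N a × + N ∣ᵤ φ a - k)
    surjective k = k ⊡ e N (+ 1) , span-scale k (e-in-Zn 1 (s≤s z≤n)) , ≋⇒∣ᵤ (φ-multiple-e₁ k)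
    ≈Q⇒≋ : ∀ a b → ≈Q N d a b → + N ∣ᵤ φ a - φ b
    ≈Q⇒≋ a b (c , c∈Zn , a-b∼ιc) = ≋⇒∣ᵤ {φ a} {φ b} (≋0⇒≋ (begin
        φ a - φ b    ≡⟨ Λ-sub index a b ⟨
        φ (a ⊟ b)    ≈⟨ φ-respects-Σ d (a ⊟ b) (ι N c) a-b∼ιc ⟩
        φ (ι N c)    ≈⟨ φ-ι c∈Zn ⟩
        + 0          ∎))
      where open ≋-Reasoning
    ≋⇒≈Q : ∀ a b → Zn N a → Zn N b → + N ∣ᵤ φ a - φ b → ≈Q N d a b
    ≋⇒≈Q a b a∈Zn b∈Zn φa≋φb = preimage-gives-≈Q (ι-image (a ⊟ b) (span-sub a∈Zn b∈Zn) φ[a-b]≋0)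
      where
      φ[a-b]≋0 : φ (a ⊟ b) ≋ + 0
      φ[a-b]≋0 = subst (_≋ + 0) (sym (Λ-sub index a b)) (≋⇒≋0 (∣ᵤ⇒≋ {φ a} {φ b} φa≋φb))
      preimage-gives-≈Q : Σ[ c ∈ R N ] (Zn N c × (ι N c ≗ a ⊟ b)) → ≈Q N d a b
      preimage-gives-≈Q (c , c∈Zn , ιc≗) =
        c , c∈Zn , span-resp (λ i → sym (trans (cong (_-_ (a i - b i)) (ιc≗ i)) (ℤP.+-inverseʳ (a i - b i))))
                             span-zero

  base : Fin N → R N
  base k = + toℕ k ⊡ e N (+ 1)

  base-in-Zn : ∀ k → Zn N (base k)
  base-in-Zn k = span-scale (+ toℕ k) (e-in-Zn 1 (s≤s z≤n))

  φ-class : ∀ k r → Zn N r → φ (base k ⊞ ι N r) ≋ + toℕ k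
  φ-class k r r∈Zn = begin
      φ (base k ⊞ ι N r)       ≡⟨ Λ-add index (base k) (ι N r) ⟩
      φ (base k) + φ (ι N r)   ≈⟨ +-cong-≋ (φ-multiple-e₁ (+ toℕ k)) (φ-ι r∈Zn) ⟩
      + toℕ k + + 0            ≡⟨ ℤP.+-identityʳ (+ toℕ k) ⟩
      + toℕ k                  ∎
    where open ≋-Reasoning

  decompose : ∀ a → Zn N a → Σ[ c ∈ R N ] (Zn N c × (ι N c ≗ a ⊟ base ⟦ φ a ⟧))
  decompose a a∈Zn = ι-image (a ⊟ base k) (span-sub a∈Zn (base-in-Zn k)) (begin
      φ (a ⊟ base k)              ≡⟨ Λ-sub index a (base k) ⟩
      φ a - φ (base k)            ≈⟨ -‿cong-≋ (≋-residue (φ a)) (φ-multiple-e₁ (+ toℕ k)) ⟩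
      + (φ a %ℕ N) - + toℕ k      ≡⟨ cong (λ x → + x - + toℕ k) (sym (toℕ-⟦⟧ (φ a))) ⟩
      + toℕ k - + toℕ k           ≡⟨ ℤP.+-inverseʳ (+ toℕ k) ⟩
      + 0                         ∎)
    where
    open ≋-Reasoning
    k : Fin N
    k = ⟦ φ a ⟧

  base-separates : ∀ d {k l r r′} → Zn N r → Zn N r′ →
                   ≈Σ N d (base k ⊞ ι N r) (base l ⊞ ι N r′) → k ≡ l
  base-separates d {k} {l} {r} {r′} r∈Zn r′∈Zn rel =
    FinP.toℕ-injective (≋⇒≡ (FinP.toℕ<n k) (FinP.toℕ<n l) (begin
      + toℕ k                ≈⟨ φ-class k r r∈Zn ⟨
      φ (base k ⊞ ι N r)     ≈⟨ φ-respects-Σ d (base k ⊞ ι N r) (base l ⊞ ι N r′) rel ⟩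
      φ (base l ⊞ ι N r′)    ≈⟨ φ-class l r′ r′∈Zn ⟩
      + toℕ l                ∎))
    where open ≋-Reasoning

  base-cancel : ∀ d {k l r r′} → k ≡ l → Zn N r → Zn N r′ →
                ≈Σ N d (base k ⊞ ι N r) (base l ⊞ ι N r′) → ≈S N d r r′
  base-cancel d {k} {r = r} {r′} refl r∈Zn r′∈Zn rel =
    kernel-lemma d (span-sub r∈Zn r′∈Zn) (span-resp cancel rel)
    where
    regroup : ∀ t x y → (t + x) - (t + y) ≡ x - y
    regroup = solve-∀
    cancel : (base k ⊞ ι N r) ⊟ (base k ⊞ ι N r′) ≗ ι N (r ⊟ r′)
    cancel i = trans (regroup (base k i) (ι N r i) (ι N r′ i)) (sym (ι-sub r r′ i))

  sizeΣ-from-S : ∀ d M → HasSize N (≈S N d) M → HasSize N (≈Σ N d) (N * M)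
  sizeΣ-from-S d M (r , r∈Zn , r-cover , r-inj) = rep , rep∈Zn , rep-cover , rep-injective
    where
    repPair : Fin N × Fin M → R N
    repPair (k , j) = base k ⊞ ι N (r j)
    rep : Fin (N * M) → R N
    rep x = repPair (remQuot {N} M x)
    rep∈Zn : ∀ x → Zn N (rep x)
    rep∈Zn x = span-add (base-in-Zn (proj₁ (remQuot {N} M x))) (ι-preserves-Zn (r∈Zn (proj₂ (remQuot {N} M x))))
    cover-from : ∀ a → Σ[ c ∈ R N ] (Zn N c × (ι N c ≗ a ⊟ base ⟦ φ a ⟧)) →
                 Σ[ x ∈ Fin (N * M) ] (≈Σ N d a (rep x))
    cover-from a (c , c∈Zn , ιc≗) =
      let (j , c∼rj) = r-cover c c∈Zn in
      combine ⟦ φ a ⟧ j , subst (λ p → ≈Σ N d a (repPair p)) (sym (FinP.remQuot-combine ⟦ φ a ⟧ j))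
                                (span-resp (shift j) (ι-maps-F-to-ℰ d c∼rj))
      where
      regroup : ∀ a t x → (a - t) - x ≡ a - (t + x)
      regroup = solve-∀
      shift : ∀ j → ι N (c ⊟ r j) ≗ a ⊟ repPair (⟦ φ a ⟧ , j)
      shift j i = trans (ι-sub c (r j) i)
        (trans (cong (_- ι N (r j) i) (ιc≗ i)) (regroup (a i) (base ⟦ φ a ⟧ i) (ι N (r j) i)))
    rep-cover : ∀ a → Zn N a → Σ[ x ∈ Fin (N * M) ] (≈Σ N d a (rep x))
    rep-cover a a∈Zn = cover-from a (decompose a a∈Zn)
    pair-injective : ∀ p q → ≈Σ N d (repPair p) (repPair q) → p ≡ q
    pair-injective (k , i) (l , j) rel = cong₂ _,_ k≡l (r-inj i j (base-cancel d k≡l (r∈Zn i) (r∈Zn j) rel))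
      where
      k≡l : k ≡ l
      k≡l = base-separates d {k} {l} {r i} {r j} (r∈Zn i) (r∈Zn j) rel
    rep-injective : ∀ x y → ≈Σ N d (rep x) (rep y) → x ≡ y
    rep-injective x y rel = begin
        x                                    ≡⟨ FinP.combine-remQuot {N} M x ⟨
        uncurry combine (remQuot {N} M x)
          ≡⟨ cong (uncurry combine) (pair-injective (remQuot {N} M x) (remQuot {N} M y) rel) ⟩
        uncurry combine (remQuot {N} M y)    ≡⟨ FinP.combine-remQuot {N} M y ⟩
        y                                    ∎
      where open ≡-Reasoning

  -- Part 3: the representatives of Σ with φ ≡ 0 pull back along ι to representatives of S,
  -- and Part 2 with the uniqueness of the size of Σ gives |Σ| = N·|S|.
  sizeS-from-Σ : ∀ d K → HasSize N (≈Σ N d) K → Σ[ M ∈ ℕ ] (HasSize N (≈S N d) M × K ≡ N * M)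
  sizeS-from-Σ d K Σ-reps@(s , s∈Zn , s-cover , s-inj) =
    count , S-reps , size-unique (ε N d) Σ-reps (sizeΣ-from-S d count S-reps)
    where
    open Enumeration (enumerate K (λ j → φ (s j) ≋? + 0))
    lift : ∀ a → Σ[ c ∈ R N ] (Zn N c × (ι N c ≗ s (elem a)))
    lift a = ι-image (s (elem a)) (s∈Zn (elem a)) (elem-sat a)
    r : Fin count → R N
    r a = proj₁ (lift a)
    r∈Zn : ∀ a → Zn N (r a)
    r∈Zn a = proj₁ (proj₂ (lift a))
    ιr≗ : ∀ a → ι N (r a) ≗ s (elem a)
    ιr≗ a = proj₂ (proj₂ (lift a))
    pull-back : ∀ {c} → Zn N c → ∀ j → ≈Σ N d (ι N c) (s j) → Σ[ a ∈ Fin count ] (elem a ≡ j) →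
                Σ[ a ∈ Fin count ] (≈S N d c (r a))
    pull-back {c} c∈Zn .(elem a) ιc∼s (a , refl) =
      a , kernel-lemma d (span-sub c∈Zn (r∈Zn a)) (span-resp (λ i →
            trans (cong (_-_ (ι N c i)) (sym (ιr≗ a i))) (sym (ι-sub c (r a) i))) ιc∼s)
    r-cover-from : ∀ {c} → Zn N c → Σ[ j ∈ Fin K ] (≈Σ N d (ι N c) (s j)) →
                   Σ[ a ∈ Fin count ] (≈S N d c (r a))
    r-cover-from {c} c∈Zn (j , ιc∼s) =
      pull-back c∈Zn j ιc∼s
        (elem-complete j (≋-trans (≋-sym (φ-respects-Σ d (ι N c) (s j) ιc∼s)) (φ-ι {c} c∈Zn)))
    r-cover : ∀ c → Zn N c → Σ[ a ∈ Fin count ] (≈S N d c (r a))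
    r-cover c c∈Zn = r-cover-from c∈Zn (s-cover (ι N c) (ι-preserves-Zn c∈Zn))
    r-injective : ∀ a b → ≈S N d (r a) (r b) → a ≡ b
    r-injective a b ra∼rb = elem-injective a b (s-inj (elem a) (elem b) (span-resp ι-diff (ι-maps-F-to-ℰ d ra∼rb)))
      where
      ι-diff : ι N (r a ⊟ r b) ≗ s (elem a) ⊟ s (elem b)
      ι-diff i = trans (ι-sub (r a) (r b) i) (cong₂ _-_ (ιr≗ a i) (ιr≗ b i))
    S-reps : HasSize N (≈S N d) count
    S-reps = r , r∈Zn , r-cover , r-injective

corollary2p6 : (n : ℕ) .{{_ : NonZero n}} (d : ℤ) → 2 ≤ ∣ d ∣ →
    QuotIsoZmod n (≈Q n d)
    × (∀ m → HasSize n (≈S n d) m → HasSize n (≈Σ n d) (n * m))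
    × (∀ k → HasSize n (≈Σ n d) k → Σ[ m ∈ ℕ ] (HasSize n (≈S n d) m × k ≡ n * m))
corollary2p6 zero {{n≢0}} d _ = ⊥-elim (ℕ.≢-nonZero⁻¹ 0 {{n≢0}} refl)
corollary2p6 (suc m) d _ = quotient≅ℤ/N d , sizeΣ-from-S d , sizeS-from-Σ d
  where open Cyclic m
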